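{- For any time warps $f,g,h$: (a) $f\backslash(g\wedge h)=(f\backslash g)\wedge(f\backslash h)$; (b) $(g\wedge h)\backslash f=(g\backslash f)\vee(h\backslash f)$; (c) $f\backslash(g\vee h)=(f\backslash g)\vee(f\backslash h)$; (d) $(g\vee h)\backslash f=(g\backslash f)\wedge(h\backslash f)$; (e) $(g\wedge h)/f=(g/f)\wedge(h/f)$; (f) $f/(g\wedge h)=(f/g)\vee(f/h)$; (g) $(g\vee h)/f=(g/f)\vee(h/f)$; (h) $f/(g\vee h)=(f/g)\wedge(f/h)$.
   Context: Let $\overline{\omega}=\omega\cup\{\omega\}$ with its natural order. A time warp is a function $f:\overline{\omega}\to\overline{\omega}$ preserving all suprema; equivalently, a monotone function with $f(0)=0$ and $f(\omega)=\bigvee\{f(n)\mid n\in\omega\}$. The set $W$ of time warps is ordered pointwise, with pointwise meet $\wedge$ and join $\vee$; $fg:=f\circ g$. The residuals $\backslash,/$ are the binary operations on $W$ satisfying $f\le h/g \iff fg\le h\iff g\le f\backslash h$ for all $f,g,h\in W$. -}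

module Defs where

open import Data.Nat as ℕ using (ℕ; zero; suc; z≤n; s≤s)
open import Data.Nat.Properties as ℕP using ()
open import Data.Product using (_×_; _,_; proj₁; proj₂)
open import Data.Sum using (_⊎_; inj₁; inj₂)
open import Data.Empty using (⊥; ⊥-elim)
open import Relation.Nullary using (¬_; Dec; yes; no)
open import Relation.Binary.PropositionalEquality using (_≡_; refl; cong₂; trans)

data ω̄ : Set where
  fin : ℕ → ω̄
  ω   : ω̄

infix 4 _≤ω_
data _≤ω_ : ω̄ → ω̄ → Set where
  fin≤fin : ∀ {m n} → m ℕ.≤ n → fin m ≤ω fin n
  x≤ω     : ∀ {x} → x ≤ω ω

≤ω-refl : ∀ {x} → x ≤ω x
≤ω-refl {fin n} = fin≤fin ℕP.≤-refl
≤ω-refl {ω} = x≤ω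

≤ω-trans : ∀ {x y z} → x ≤ω y → y ≤ω z → x ≤ω z
≤ω-trans (fin≤fin p) (fin≤fin q) = fin≤fin (ℕP.≤-trans p q)
≤ω-trans _ x≤ω = x≤ω

≤ω-total : ∀ x y → x ≤ω y ⊎ y ≤ω x
≤ω-total (fin m) (fin n) with ℕP.≤-total m n
... | inj₁ p = inj₁ (fin≤fin p)
... | inj₂ p = inj₂ (fin≤fin p)
≤ω-total x ω = inj₁ x≤ω
≤ω-total ω y = inj₂ x≤ω

_≤ω?_ : ∀ x y → Dec (x ≤ω y)
fin m ≤ω? fin n with m ℕP.≤? n
... | yes p = yes (fin≤fin p)
... | no ¬p = no λ { (fin≤fin p) → ¬p p }
x ≤ω? ω = yes x≤ω
ω ≤ω? fin n = no λ ()

not≤ : ∀ {x y} → ¬ (x ≤ω y) → y ≤ω x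
not≤ {x} {y} ¬p with ≤ω-total x y
... | inj₁ p = ⊥-elim (¬p p)
... | inj₂ p = p

minω : ω̄ → ω̄ → ω̄
minω x y with x ≤ω? y
... | yes _ = x
... | no _ = y

maxω : ω̄ → ω̄ → ω̄
maxω x y with x ≤ω? y
... | yes _ = y
... | no _ = x

min≤ˡ : ∀ x y → minω x y ≤ω x
min≤ˡ x y with x ≤ω? y
... | yes _ = ≤ω-refl
... | no ¬p = not≤ ¬p

min≤ʳ : ∀ x y → minω x y ≤ω y
min≤ʳ x y with x ≤ω? y
... | yes p = p
... | no _ = ≤ω-refl

min-glb : ∀ {z} x y → z ≤ω x → z ≤ω y → z ≤ω minω x y
min-glb x y p q with x ≤ω? y
... | yes _ = p
... | no _ = q

min-split : ∀ {u} x y → minω x y ≤ω u → x ≤ω u ⊎ y ≤ω u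
min-split x y p with x ≤ω? y
... | yes _ = inj₁ p
... | no _ = inj₂ p

min-idem : ∀ x → minω x x ≡ x
min-idem x with x ≤ω? x
... | yes _ = refl
... | no _ = refl

≤max-ˡ : ∀ x y → x ≤ω maxω x y
≤max-ˡ x y with x ≤ω? y
... | yes p = p
... | no _ = ≤ω-refl

≤max-ʳ : ∀ x y → y ≤ω maxω x y
≤max-ʳ x y with x ≤ω? y
... | yes _ = ≤ω-refl
... | no ¬p = not≤ ¬p

max-lub : ∀ {u} x y → x ≤ω u → y ≤ω u → maxω x y ≤ω u
max-lub x y p q with x ≤ω? y
... | yes _ = q
... | no _ = p

max-idem : ∀ x → maxω x x ≡ x
max-idem x with x ≤ω? x
... | yes _ = refl
... | no _ = refl

IsLub : (ℕ → ω̄) → ω̄ → Set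
IsLub s v = (∀ n → s n ≤ω v) × (∀ u → (∀ n → s n ≤ω u) → v ≤ω u)

record TimeWarp : Set where
  field
    fun  : ω̄ → ω̄
    mono : ∀ {x y} → x ≤ω y → fun x ≤ω fun y
    fun0 : fun (fin 0) ≡ fin 0
    funω : IsLub (λ n → fun (fin n)) (fun ω)
open TimeWarp public

W : Set
W = TimeWarp

infix 4 _⊑_ _≈_
_⊑_ : W → W → Set
f ⊑ g = ∀ x → fun f x ≤ω fun g x

_≈_ : W → W → Set
f ≈ g = ∀ x → fun f x ≡ fun g x

CompLe : W → W → W → Set
CompLe f g h = ∀ x → fun f (fun g x) ≤ω fun h x

private
  meet-least : (f g : W) → ∀ u → (∀ n → minω (fun f (fin n)) (fun g (fin n)) ≤ω u)
             → minω (fun f ω) (fun g ω) ≤ω u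
  meet-least f g u H with fun f ω ≤ω? u | fun g ω ≤ω? u
  ... | yes p | _ = ≤ω-trans (min≤ˡ (fun f ω) (fun g ω)) p
  ... | no _ | yes q = ≤ω-trans (min≤ʳ (fun f ω) (fun g ω)) q
  ... | no ¬p | no ¬q = ⊥-elim (¬p (proj₂ (funω f) u F))
    where
    F : ∀ n → fun f (fin n) ≤ω u
    F n with fun f (fin n) ≤ω? u
    ... | yes r = r
    ... | no ¬r = ⊥-elim (¬q (proj₂ (funω g) u G))
      where
      G : ∀ n' → fun g (fin n') ≤ω u
      G n' with ℕP.≤-total n' n
      ... | inj₁ n'≤n with min-split (fun f (fin n)) (fun g (fin n)) (H n)
      ...   | inj₁ r = ⊥-elim (¬r r)
      ...   | inj₂ r = ≤ω-trans (mono g (fin≤fin n'≤n)) r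
      G n' | inj₂ n≤n' with min-split (fun f (fin n')) (fun g (fin n')) (H n')
      ...   | inj₁ r = ⊥-elim (¬r (≤ω-trans (mono f (fin≤fin n≤n')) r))
      ...   | inj₂ r = r

infixr 7 _∧_
infixr 6 _∨_
_∧_ : W → W → W
fun (f ∧ g) x = minω (fun f x) (fun g x)
mono (f ∧ g) {x} {y} p = min-glb (fun f y) (fun g y) (≤ω-trans (min≤ˡ (fun f x) (fun g x)) (mono f p)) (≤ω-trans (min≤ʳ (fun f x) (fun g x)) (mono g p))
fun0 (f ∧ g) = trans (cong₂ minω (fun0 f) (fun0 g)) (min-idem (fin 0))
funω (f ∧ g) = (λ n → mono (f ∧ g) x≤ω) , meet-least f g

_∨_ : W → W → W
fun (f ∨ g) x = maxω (fun f x) (fun g x)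
mono (f ∨ g) {x} {y} p = max-lub (fun f x) (fun g x) (≤ω-trans (mono f p) (≤max-ˡ (fun f y) (fun g y))) (≤ω-trans (mono g p) (≤max-ʳ (fun f y) (fun g y)))
fun0 (f ∨ g) = trans (cong₂ maxω (fun0 f) (fun0 g)) (max-idem (fin 0))
funω (f ∨ g) = (λ n → mono (f ∨ g) x≤ω) ,
  λ u H → max-lub (fun f ω) (fun g ω) (proj₂ (funω f) u (λ n → ≤ω-trans (≤max-ˡ (fun f (fin n)) (fun g (fin n))) (H n)))
                      (proj₂ (funω g) u (λ n → ≤ω-trans (≤max-ʳ (fun f (fin n)) (fun g (fin n))) (H n)))

AreResiduals : (W → W → W) → (W → W → W) → Set
AreResiduals _under_ _over_ = ∀ f g h →
  ((f ⊑ h over g → CompLe f g h) × (CompLe f g h → f ⊑ h over g)) ×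
  ((g ⊑ f under h → CompLe f g h) × (CompLe f g h → g ⊑ f under h))

{-# OPTIONS --safe #-}
-- Laws (a), (d), (e), (h) hold in any residuated lattice whose elements preserve binary joins,
-- and warps do since ω̄ is a chain. For the other four, write a warp k as the join of its step
-- warps stepAt k n (0 up to n, then k (n + 1)). Whether a step warp lies below f \ g or g / f
-- is decided by a single inequality in ω̄, resp. an inclusion between up-sets of ω̄; as the
-- up-sets of a chain are linearly ordered, each step of the residual of a meet or join then
-- falls below one of the two joinands.
module Submission where

open import Defs
open import Level using (Level; 0ℓ)
open import Data.Nat using (ℕ; zero; suc; z≤n)
import Data.Nat.Properties as ℕₚ
open import Data.Product using (_×_; _,_; proj₁; proj₂)
open import Data.Sum using (_⊎_; inj₁; inj₂; [_,_]′; fromInj₂; map)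
open import Data.Empty using (⊥-elim)
open import Function using (id)
open import Relation.Nullary using (¬_; yes; no; contradiction)
open import Relation.Unary using (Pred; _⊆_; _∩_; _∪_; Decidable)
open import Relation.Binary using (Rel; Total; _Respects_)
open import Relation.Binary.PropositionalEquality using (_≡_; refl; cong; sym; subst)

module _ {a ℓ p : Level} {A : Set a} {_≼_ : Rel A ℓ} (total : Total _≼_) where

  upSet-⊈⇒⊇ : {U V : Pred A p} → Decidable U → U Respects _≼_ → V Respects _≼_ →
              ¬ (U ⊆ V) → V ⊆ U
  upSet-⊈⇒⊇ {U} {V} U? U↑ V↑ U⊈V {y} y∈V with U? y
  ... | yes y∈U = y∈U
  ... | no y∉U = ⊥-elim (U⊈V U⊆V)
    where
    U⊆V : U ⊆ V
    U⊆V {z} z∈U with total y z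
    ... | inj₁ y≼z = V↑ y≼z y∈V
    ... | inj₂ z≼y = contradiction (U↑ z≼y z∈U) y∉U

  upSet-∩-⊆ : {U V C : Pred A p} → Decidable U → U Respects _≼_ → V Respects _≼_ →
              U ∩ V ⊆ C → ¬ (U ⊆ C) → V ⊆ C
  upSet-∩-⊆ {U} {V} U? U↑ V↑ U∩V⊆C U⊈C y∈V = U∩V⊆C (V⊆U y∈V , y∈V)
    where
    V⊆U : V ⊆ U
    V⊆U = upSet-⊈⇒⊇ U? U↑ V↑ λ U⊆V → U⊈C λ y∈U → U∩V⊆C (y∈U , U⊆V y∈U)

  upSet-⊆-∪ : {S U V : Pred A p} → Decidable V → U Respects _≼_ → V Respects _≼_ →
              S ⊆ U ∪ V → ¬ (S ⊆ U) → S ⊆ V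
  upSet-⊆-∪ {S} {U} {V} V? U↑ V↑ S⊆U∪V S⊈U y∈S = [ U⊆V , id ]′ (S⊆U∪V y∈S)
    where
    U⊆V : U ⊆ V
    U⊆V = upSet-⊈⇒⊇ V? V↑ U↑ λ V⊆U → S⊈U λ y∈S → [ id , V⊆U ]′ (S⊆U∪V y∈S)

0≤ω : ∀ x → fin 0 ≤ω x
0≤ω (fin n) = fin≤fin z≤n
0≤ω ω = x≤ω

≤ω-antisym : ∀ {x y} → x ≤ω y → y ≤ω x → x ≡ y
≤ω-antisym (fin≤fin p) (fin≤fin q) = cong fin (ℕₚ.≤-antisym p q)
≤ω-antisym x≤ω x≤ω = refl

max-split : ∀ {v} x y → v ≤ω maxω x y → v ≤ω x ⊎ v ≤ω y
max-split x y v≤ with x ≤ω? y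
... | yes _ = inj₂ v≤
... | no _ = inj₁ v≤

≤max-unless : ∀ {v} x y → (¬ v ≤ω x → v ≤ω y) → v ≤ω maxω x y
≤max-unless {v} x y ≰x⇒≤y with v ≤ω? x
... | yes v≤x = ≤ω-trans v≤x (≤max-ˡ x y)
... | no v≰x = ≤ω-trans (≰x⇒≤y v≰x) (≤max-ʳ x y)

-- Record wrappers of ⊑ and CompLe: unlike these pointwise definitions they let Agda infer the warps.
infix 4 _≤_ _·_≤_

record _≤_ (f g : W) : Set where
  constructor pointwise
  field at : f ⊑ g
open _≤_

record _·_≤_ (f g h : W) : Set where
  constructor pointwise·
  field at· : CompLe f g h
open _·_≤_

≤-refl : ∀ {f} → f ≤ f
≤-refl = pointwise λ _ → ≤ω-refl

≤-antisym : ∀ {f g} → f ≤ g → g ≤ f → f ≈ g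
≤-antisym f≤g g≤f x = ≤ω-antisym (at f≤g x) (at g≤f x)

x∧y≤x : ∀ f g → f ∧ g ≤ f
x∧y≤x f g = pointwise λ x → min≤ˡ (fun f x) (fun g x)

x∧y≤y : ∀ f g → f ∧ g ≤ g
x∧y≤y f g = pointwise λ x → min≤ʳ (fun f x) (fun g x)

∧-greatest : ∀ {f g h} → h ≤ f → h ≤ g → h ≤ f ∧ g
∧-greatest {f} {g} h≤f h≤g = pointwise λ x → min-glb (fun f x) (fun g x) (at h≤f x) (at h≤g x)

x≤x∨y : ∀ f g → f ≤ f ∨ g
x≤x∨y f g = pointwise λ x → ≤max-ˡ (fun f x) (fun g x)

y≤x∨y : ∀ f g → g ≤ f ∨ g
y≤x∨y f g = pointwise λ x → ≤max-ʳ (fun f x) (fun g x)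

∨-least : ∀ {f g h} → f ≤ h → g ≤ h → f ∨ g ≤ h
∨-least {f} {g} f≤h g≤h = pointwise λ x → max-lub (fun f x) (fun g x) (at f≤h x) (at g≤h x)

·≤-resp : ∀ {f f′ g g′ h h′} → f′ ≤ f → g′ ≤ g → h ≤ h′ → f · g ≤ h → f′ · g′ ≤ h′
·≤-resp {f} {g′ = g′} f′≤f g′≤g h≤h′ fg≤h = pointwise· λ x →
  ≤ω-trans (at f′≤f (fun g′ x)) (≤ω-trans (mono f (at g′≤g x)) (≤ω-trans (at· fg≤h x) (at h≤h′ x)))

·≤-∧ : ∀ {f g h h′} → f · g ≤ h → f · g ≤ h′ → f · g ≤ h ∧ h′
·≤-∧ {h = h} {h′} fg≤h fg≤h′ = pointwise· λ x → min-glb (fun h x) (fun h′ x) (at· fg≤h x) (at· fg≤h′ x)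

∨·-≤ : ∀ {f f′ g h} → f · g ≤ h → f′ · g ≤ h → f ∨ f′ · g ≤ h
∨·-≤ {f} {f′} {g} fg≤h f′g≤h = pointwise· λ x →
  max-lub (fun f (fun g x)) (fun f′ (fun g x)) (at· fg≤h x) (at· f′g≤h x)

-- Needs ω̄ to be a chain: f (g x ⊔ g′ x) is f (g x) or f (g′ x).
·∨-≤ : ∀ {f g g′ h} → f · g ≤ h → f · g′ ≤ h → f · g ∨ g′ ≤ h
·∨-≤ {f} {g} {g′} {h} fg≤h fg′≤h = pointwise· λ x → bound x (≤ω-total (fun g x) (fun g′ x))
  where
  bound : ∀ x → fun g x ≤ω fun g′ x ⊎ fun g′ x ≤ω fun g x → fun f (fun (g ∨ g′) x) ≤ω fun h x
  bound x (inj₁ gx≤g′x) = ≤ω-trans (mono f (max-lub _ _ gx≤g′x ≤ω-refl)) (at· fg′≤h x)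
  bound x (inj₂ g′x≤gx) = ≤ω-trans (mono f (max-lub _ _ ≤ω-refl g′x≤gx)) (at· fg≤h x)

stepFun : ℕ → ω̄ → ω̄ → ω̄
stepFun n v (fin m) with m ℕₚ.≤? n
... | yes _ = fin 0
... | no _ = v
stepFun n v ω = v

stepFun-above : ∀ n v {y} → fin (suc n) ≤ω y → stepFun n v y ≡ v
stepFun-above n v {fin m} (fin≤fin n<m) with m ℕₚ.≤? n
... | yes m≤n = contradiction m≤n (ℕₚ.<⇒≱ n<m)
... | no _ = refl
stepFun-above n v {ω} _ = refl

stepFun-cases : ∀ n v y → stepFun n v y ≡ fin 0 ⊎ fin (suc n) ≤ω y
stepFun-cases n v (fin m) with m ℕₚ.≤? n
... | yes _ = inj₁ refl
... | no m≰n = inj₂ (fin≤fin (ℕₚ.≰⇒> m≰n))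
stepFun-cases n v ω = inj₂ x≤ω

stepFun-mono : ∀ n v {x y} → x ≤ω y → stepFun n v x ≤ω stepFun n v y
stepFun-mono n v {x} {y} x≤y with stepFun-cases n v x
... | inj₁ eq rewrite eq = 0≤ω _
... | inj₂ above rewrite stepFun-above n v above | stepFun-above n v (≤ω-trans above x≤y) = ≤ω-refl

step : ℕ → ω̄ → W
fun (step n v) = stepFun n v
mono (step n v) = stepFun-mono n v
fun0 (step n v) with stepFun-cases n v (fin 0)
... | inj₁ eq = eq
... | inj₂ (fin≤fin ())
funω (step n v) = (λ _ → stepFun-mono n v x≤ω) , λ u bound →
  subst (_≤ω u) (stepFun-above n v ≤ω-refl) (bound (suc n))

step-at : ∀ n v → fun (step n v) (fin (suc n)) ≡ v
step-at n v = stepFun-above n v ≤ω-refl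

step≤⇒≤ : ∀ n v {f} → step n v ≤ f → v ≤ω fun f (fin (suc n))
step≤⇒≤ n v σ≤f = subst (_≤ω _) (step-at n v) (at σ≤f (fin (suc n)))

·step-≤ : ∀ {f g} n v → fun f v ≤ω fun g (fin (suc n)) → f · step n v ≤ g
·step-≤ {f} {g} n v fv≤gx = pointwise· λ y → bound y (stepFun-cases n v y)
  where
  bound : ∀ y → stepFun n v y ≡ fin 0 ⊎ fin (suc n) ≤ω y → fun f (stepFun n v y) ≤ω fun g y
  bound y (inj₁ eq) rewrite eq | fun0 f = 0≤ω _
  bound y (inj₂ above) rewrite stepFun-above n v above = ≤ω-trans fv≤gx (mono g above)

Reaches : W → ω̄ → Pred ω̄ 0ℓ
Reaches f x y = x ≤ω fun f y

reaches? : ∀ f x → Decidable (Reaches f x)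
reaches? f x y = x ≤ω? fun f y

reaches-upSet : ∀ f x → Reaches f x Respects _≤ω_
reaches-upSet f x y≤z x≤fy = ≤ω-trans x≤fy (mono f y≤z)

step·-≤ : ∀ {f g} n v → Reaches f (fin (suc n)) ⊆ Reaches g v → step n v · f ≤ g
step·-≤ {f} {g} n v reach⊆ = pointwise· λ y → bound y (stepFun-cases n v (fun f y))
  where
  bound : ∀ y → stepFun n v (fun f y) ≡ fin 0 ⊎ fin (suc n) ≤ω fun f y → stepFun n v (fun f y) ≤ω fun g y
  bound y (inj₁ eq) rewrite eq = 0≤ω _
  bound y (inj₂ above) rewrite stepFun-above n v above = reach⊆ above

stepAt : W → ℕ → W
stepAt k n = step n (fun k (fin (suc n)))

-- k is the join of the step warps stepAt k n, so k ≤ f ∨ g can be checked one step at a time.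
≤-∨-bySteps : ∀ k {f g} → (∀ n → ¬ stepAt k n ≤ f → stepAt k n ≤ g) → k ≤ f ∨ g
≤-∨-bySteps k {f} {g} cover = pointwise below
  where
  belowFin : ∀ n → fun k (fin n) ≤ω fun (f ∨ g) (fin n)
  belowFin zero = subst (_≤ω _) (sym (fun0 k)) (0≤ω _)
  belowFin (suc n) = ≤max-unless (fun f x) (fun g x) λ ≰f →
    step≤⇒≤ n v (cover n λ σ≤f → ≰f (step≤⇒≤ n v σ≤f))
    where
    x v : ω̄
    x = fin (suc n)
    v = fun k x
  below : k ⊑ f ∨ g
  below (fin n) = belowFin n
  below ω = proj₂ (funω k) _ λ n → ≤ω-trans (belowFin n) (mono (f ∨ g) x≤ω)

≤-∨-bySteps-⊎ : ∀ k {f g} → (∀ n → stepAt k n ≤ f ⊎ stepAt k n ≤ g) → k ≤ f ∨ g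
≤-∨-bySteps-⊎ k split = ≤-∨-bySteps k λ n σ≰f → fromInj₂ (λ σ≤f → contradiction σ≤f σ≰f) (split n)

module Residuation (_\\_ _/_ : W → W → W) (residuals : AreResiduals _\\_ _/_) where

  /-intro : ∀ {f g h} → f · g ≤ h → f ≤ h / g
  /-intro {f} {g} {h} fg≤h = pointwise (proj₂ (proj₁ (residuals f g h)) (at· fg≤h))

  /-elim : ∀ {f g h} → f ≤ h / g → f · g ≤ h
  /-elim {f} {g} {h} f≤h/g = pointwise· (proj₁ (proj₁ (residuals f g h)) (at f≤h/g))

  \\-intro : ∀ {f g h} → f · g ≤ h → g ≤ f \\ h
  \\-intro {f} {g} {h} fg≤h = pointwise (proj₂ (proj₂ (residuals f g h)) (at· fg≤h))

  \\-elim : ∀ {f g h} → g ≤ f \\ h → f · g ≤ h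
  \\-elim {f} {g} {h} g≤f\\h = pointwise· (proj₁ (proj₂ (residuals f g h)) (at g≤f\\h))

  /-counit : ∀ {g h} → h / g · g ≤ h
  /-counit = /-elim ≤-refl

  \\-counit : ∀ {f h} → f · f \\ h ≤ h
  \\-counit = \\-elim ≤-refl

  \\-monoʳ : ∀ {f h h′} → h ≤ h′ → f \\ h ≤ f \\ h′
  \\-monoʳ h≤h′ = \\-intro (·≤-resp ≤-refl ≤-refl h≤h′ \\-counit)

  \\-antimonoˡ : ∀ {f f′ h} → f′ ≤ f → f \\ h ≤ f′ \\ h
  \\-antimonoˡ f′≤f = \\-intro (·≤-resp f′≤f ≤-refl ≤-refl \\-counit)

  /-monoˡ : ∀ {g h h′} → h ≤ h′ → h / g ≤ h′ / g
  /-monoˡ h≤h′ = /-intro (·≤-resp ≤-refl ≤-refl h≤h′ /-counit)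

  /-antimonoʳ : ∀ {g g′ h} → g′ ≤ g → h / g ≤ h / g′
  /-antimonoʳ g′≤g = /-intro (·≤-resp ≤-refl g′≤g ≤-refl /-counit)

  step≤\\ : ∀ {f g} n v → fun f v ≤ω fun g (fin (suc n)) → step n v ≤ f \\ g
  step≤\\ n v fv≤gx = \\-intro (·step-≤ n v fv≤gx)

  step≤/ : ∀ {f g} n v → Reaches f (fin (suc n)) ⊆ Reaches g v → step n v ≤ g / f
  step≤/ n v reach⊆ = /-intro (step·-≤ n v reach⊆)

  \\-distribˡ-∧ : ∀ f g h → f \\ (g ∧ h) ≈ (f \\ g) ∧ (f \\ h)
  \\-distribˡ-∧ f g h = ≤-antisym
    (∧-greatest (\\-monoʳ (x∧y≤x g h)) (\\-monoʳ (x∧y≤y g h)))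
    (\\-intro (·≤-∧ (\\-elim (x∧y≤x (f \\ g) (f \\ h))) (\\-elim (x∧y≤y (f \\ g) (f \\ h)))))

  \\-antidistribʳ-∨ : ∀ f g h → (g ∨ h) \\ f ≈ (g \\ f) ∧ (h \\ f)
  \\-antidistribʳ-∨ f g h = ≤-antisym
    (∧-greatest (\\-antimonoˡ (x≤x∨y g h)) (\\-antimonoˡ (y≤x∨y g h)))
    (\\-intro (∨·-≤ (\\-elim (x∧y≤x (g \\ f) (h \\ f))) (\\-elim (x∧y≤y (g \\ f) (h \\ f)))))

  /-distribʳ-∧ : ∀ f g h → (g ∧ h) / f ≈ (g / f) ∧ (h / f)
  /-distribʳ-∧ f g h = ≤-antisym
    (∧-greatest (/-monoˡ (x∧y≤x g h)) (/-monoˡ (x∧y≤y g h)))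
    (/-intro (·≤-∧ (/-elim (x∧y≤x (g / f) (h / f))) (/-elim (x∧y≤y (g / f) (h / f)))))

  /-antidistribˡ-∨ : ∀ f g h → f / (g ∨ h) ≈ (f / g) ∧ (f / h)
  /-antidistribˡ-∨ f g h = ≤-antisym
    (∧-greatest (/-antimonoʳ (x≤x∨y g h)) (/-antimonoʳ (y≤x∨y g h)))
    (/-intro (·∨-≤ (/-elim (x∧y≤x (f / g) (f / h))) (/-elim (x∧y≤y (f / g) (f / h)))))

  \\-antidistribʳ-∧ : ∀ f g h → (g ∧ h) \\ f ≈ (g \\ f) ∨ (h \\ f)
  \\-antidistribʳ-∧ f g h = ≤-antisym
    (≤-∨-bySteps-⊎ k λ n → let x = fin (suc n) ; v = fun k x in
      map (step≤\\ n v) (step≤\\ n v) (min-split (fun g v) (fun h v) (at· (\\-counit {g ∧ h} {f}) x)))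
    (∨-least (\\-antimonoˡ (x∧y≤x g h)) (\\-antimonoˡ (x∧y≤y g h)))
    where
    k : W
    k = (g ∧ h) \\ f

  \\-distribˡ-∨ : ∀ f g h → f \\ (g ∨ h) ≈ (f \\ g) ∨ (f \\ h)
  \\-distribˡ-∨ f g h = ≤-antisym
    (≤-∨-bySteps-⊎ k λ n → let x = fin (suc n) ; v = fun k x in
      map (step≤\\ n v) (step≤\\ n v) (max-split (fun g x) (fun h x) (at· (\\-counit {f} {g ∨ h}) x)))
    (∨-least (\\-monoʳ (x≤x∨y g h)) (\\-monoʳ (y≤x∨y g h)))
    where
    k : W
    k = f \\ (g ∨ h)

  /-antidistribˡ-∧ : ∀ f g h → f / (g ∧ h) ≈ (f / g) ∨ (f / h)
  /-antidistribˡ-∧ f g h = ≤-antisym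
    (≤-∨-bySteps k λ n σ≰f/g → let x = fin (suc n) ; v = fun k x in
      step≤/ n v (upSet-∩-⊆ ≤ω-total (reaches? g x) (reaches-upSet g x) (reaches-upSet h x)
                   (reachesBoth x) (λ reach⊆ → σ≰f/g (step≤/ n v reach⊆))))
    (∨-least (/-antimonoʳ (x∧y≤x g h)) (/-antimonoʳ (x∧y≤y g h)))
    where
    k : W
    k = f / (g ∧ h)
    reachesBoth : ∀ x → Reaches g x ∩ Reaches h x ⊆ Reaches f (fun k x)
    reachesBoth x {y} (x≤gy , x≤hy) =
      ≤ω-trans (mono k (min-glb (fun g y) (fun h y) x≤gy x≤hy)) (at· (/-counit {g ∧ h} {f}) y)

  /-distribʳ-∨ : ∀ f g h → (g ∨ h) / f ≈ (g / f) ∨ (h / f)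
  /-distribʳ-∨ f g h = ≤-antisym
    (≤-∨-bySteps k λ n σ≰g/f → let x = fin (suc n) ; v = fun k x in
      step≤/ n v (upSet-⊆-∪ ≤ω-total (reaches? h v) (reaches-upSet g v) (reaches-upSet h v)
                   (reachesEither x) (λ reach⊆ → σ≰g/f (step≤/ n v reach⊆))))
    (∨-least (/-monoˡ (x≤x∨y g h)) (/-monoˡ (y≤x∨y g h)))
    where
    k : W
    k = (g ∨ h) / f
    reachesEither : ∀ x → Reaches f x ⊆ Reaches g (fun k x) ∪ Reaches h (fun k x)
    reachesEither x {y} x≤fy =
      max-split (fun g y) (fun h y) (≤ω-trans (mono k x≤fy) (at· (/-counit {f} {g ∨ h}) y))

lemma2p2 : (_\\_ _/_ : W → W → W) → AreResiduals _\\_ _/_ →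
    (f g h : W) →
    (f \\ (g ∧ h) ≈ (f \\ g) ∧ (f \\ h)) ×
    ((g ∧ h) \\ f ≈ (g \\ f) ∨ (h \\ f)) ×
    (f \\ (g ∨ h) ≈ (f \\ g) ∨ (f \\ h)) ×
    ((g ∨ h) \\ f ≈ (g \\ f) ∧ (h \\ f)) ×
    ((g ∧ h) / f ≈ (g / f) ∧ (h / f)) ×
    (f / (g ∧ h) ≈ (f / g) ∨ (f / h)) ×
    ((g ∨ h) / f ≈ (g / f) ∨ (h / f)) ×
    (f / (g ∨ h) ≈ (f / g) ∧ (f / h))
lemma2p2 _\\_ _/_ residuals f g h =
  \\-distribˡ-∧ f g h , \\-antidistribʳ-∧ f g h , \\-distribˡ-∨ f g h , \\-antidistribʳ-∨ f g h ,
  /-distribʳ-∧ f g h , /-antidistribˡ-∧ f g h , /-distribʳ-∨ f g h , /-antidistribˡ-∨ f g h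
  where open Residuation _\\_ _/_ residuals
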